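{- Let $M$ be a modular lattice of finite length with greatest element $1$ and least element $0$. Let $S(M)$ be the set of least elements of the maximal atomistic intervals of $M$. (f) $S(M)=\{x\in M: x^{*+}=x\}$. The maximal atomistic intervals of $M$ are exactly the intervals $[x,x^*]$ with $x\in S(M)$. (g) $S(M)$ is a sub-join-semilattice of $M$, with greatest element $1^+$ and least element $0$. Ordered by the order of $M$, $S(M)$ is a lattice $(S(M),\vee,\wedge)$ with $x\vee y=x+y$ and $x\wedge y=(x\cdot y)^{*+}$.
   Context: A partially ordered set is of finite length if every chain in it is finite. $+$ and $\cdot$ denote join and meet in $M$, and $a\prec b$ means $b$ covers $a$. An interval $[a,b]$ is atomistic if every element of it is a join of atoms of $[a,b]$, i.e. of elements covering $a$ in $[a,b]$. A maximal atomistic interval is an atomistic interval not properly contained in another atomistic interval. For $a\in M$: - $a^*=\sup\{b: a\prec b\}$ if $a<1$, and $1^*=1$; - $a^+=\inf\{b: b\prec a\}$ if $a>0$, and $0^+=0$. $a^{*+}$ means $(a^*)^+$. -}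

module Defs where

open import Level using (Level; _⊔_; suc)
open import Data.Product using (Σ; ∃; _×_; _,_)
open import Data.Sum using (_⊎_)
open import Data.List using (List)
open import Data.List.Relation.Unary.Any using (Any)
open import Relation.Nullary using (¬_)
open import Relation.Unary using (Pred)
open import Relation.Binary.Lattice.Bundles using (BoundedLattice)

module LatticeNotions {c ℓ₁ ℓ₂ : Level} (M : BoundedLattice c ℓ₁ ℓ₂) where
  open BoundedLattice M

  lvl : Level
  lvl = c ⊔ ℓ₁ ⊔ ℓ₂

  _<_ : Carrier → Carrier → Set (ℓ₁ ⊔ ℓ₂)
  a < b = a ≤ b × ¬ (a ≈ b)

  IsModular : Set (c ⊔ ℓ₁ ⊔ ℓ₂)
  IsModular = ∀ x y z → x ≤ z → (x ∨ (y ∧ z)) ≈ ((x ∨ y) ∧ z)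

  IsChain : Pred Carrier lvl → Set lvl
  IsChain C = ∀ x y → C x → C y → (x ≤ y ⊎ y ≤ x)

  IsFinite : Pred Carrier lvl → Set lvl
  IsFinite C = Σ (List Carrier) λ l → ∀ x → C x → Any (λ y → x ≈ y) l

  FiniteLength : Set (suc lvl)
  FiniteLength = ∀ (C : Pred Carrier lvl) → IsChain C → IsFinite C

  _≺_ : Carrier → Carrier → Set (c ⊔ ℓ₁ ⊔ ℓ₂)
  a ≺ b = a < b × ¬ (Σ Carrier λ z → a < z × z < b)

  IsSup : Pred Carrier lvl → Carrier → Set lvl
  IsSup P s = (∀ b → P b → b ≤ s) × (∀ u → (∀ b → P b → b ≤ u) → s ≤ u)

  IsInf : Pred Carrier lvl → Carrier → Set lvl
  IsInf P s = (∀ b → P b → s ≤ b) × (∀ u → (∀ b → P b → u ≤ b) → u ≤ s)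

  IsStar : Carrier → Carrier → Set lvl
  IsStar a s = (a ≈ ⊤ → s ≈ ⊤) × (¬ (a ≈ ⊤) → IsSup (λ b → a ≺ b) s)

  IsPlus : Carrier → Carrier → Set lvl
  IsPlus a s = (a ≈ ⊥ → s ≈ ⊥) × (¬ (a ≈ ⊥) → IsInf (λ b → b ≺ a) s)

  IsAtomOf : Carrier → Carrier → Carrier → Set lvl
  IsAtomOf a b z = a ≺ z × z ≤ b

  IsJoinIn : Carrier → Carrier → Pred Carrier lvl → Carrier → Set lvl
  IsJoinIn a b A z =
    (a ≤ z × z ≤ b) × (∀ w → A w → w ≤ z) ×
    (∀ u → a ≤ u → u ≤ b → (∀ w → A w → w ≤ u) → z ≤ u)

  IsAtomistic : Carrier → Carrier → Set (suc lvl)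
  IsAtomistic a b =
    a ≤ b ×
    (∀ z → a ≤ z → z ≤ b →
      Σ (Pred Carrier lvl) λ A → (∀ w → A w → IsAtomOf a b w) × IsJoinIn a b A z)

  IsMaxAtomistic : Carrier → Carrier → Set (suc lvl)
  IsMaxAtomistic a b =
    IsAtomistic a b ×
    (∀ c' d → IsAtomistic c' d → c' ≤ a → b ≤ d → (c' ≈ a × d ≈ b))

  InS : Carrier → Set (suc lvl)
  InS x = Σ Carrier λ y → IsMaxAtomistic x y

{-# OPTIONS --safe #-}
-- The interval [x, x*] is atomistic (each of its elements is the join of the atoms of x
-- below it), and an interval [a, b] is atomistic exactly when b ≤ a*.  Hence [a, b] is
-- maximal atomistic iff b = a* and a is minimal among the c ≤ a with a* ≤ c*.  Two facts
-- about a modular lattice of finite length drive everything: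
--   (i)  c ≤ y ≤ c* implies y⁺ ≤ c, and dually c⁺ ≤ y ≤ c implies c ≤ y*; so
--        x*⁺ ≤ x ≤ x⁺*, and the minimal a above are exactly the fixed points of *⁺;
--   (ii) if s* ≤ t* then x* ≤ (x · t)* for every x ≤ s.
-- Taking t = s*⁺ in (ii) shows that every x ∈ S(M) below s lies below s*⁺, which gives
-- closure under joins, the top element 1⁺ and the meet (x · y)*⁺.  Modularity enters
-- through transposition of covers along perspective intervals; finite length, together
-- with excluded middle, provides maximal elements.
module Submission where

open import Defs
open import Level using (Level; Lift; lift; _⊔_)
open import Data.Product using (Σ; ∃; ∃₂; _×_; _,_; proj₁; proj₂)
import Data.Product as Product
open import Data.Sum using (_⊎_; inj₁; inj₂; [_,_]′) renaming (swap to ⊎-swap)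
import Data.Sum as Sum
open import Data.Empty using (⊥-elim)
open import Data.Nat as ℕ using (ℕ; zero; suc; _≤′_; ≤′-refl; ≤′-step)
import Data.Nat.Properties as ℕₚ
open import Data.Fin using (Fin; toℕ)
open import Data.Fin.Properties using (pigeonhole)
open import Data.List using (List; length; lookup)
open import Data.List.Relation.Unary.Any using (Any; index)
open import Data.List.Relation.Unary.Any.Properties using (lookup-index)
open import Relation.Binary.PropositionalEquality using (cong)
open import Relation.Nullary using (¬_; yes; no)
open import Relation.Nullary.Decidable using (decidable-stable)
open import Relation.Unary using (Pred)
open import Function using (id; flip; _∘_)
open import Function.Bundles using (_⇔_; mk⇔; Equivalence)
open import Function.Construct.Composition using (_⇔-∘_)
open import Axiom.ExcludedMiddle using (ExcludedMiddle)
open import Relation.Binary.Lattice.Bundles using (BoundedLattice)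
import Relation.Binary.Lattice.Properties.Lattice as LatticeProperties
import Relation.Binary.Lattice.Properties.JoinSemilattice as JoinProperties
import Relation.Binary.Lattice.Properties.MeetSemilattice as MeetProperties
import Relation.Binary.Reasoning.Setoid as ≈-Reasoning
import Relation.Binary.Reasoning.PartialOrder as ≤-Reasoning

module ChainConditions {c ℓ₁ ℓ₂} (M : BoundedLattice c ℓ₁ ℓ₂)
  (lem : ∀ {ℓ} → ExcludedMiddle ℓ) (finite : LatticeNotions.FiniteLength M) where
  open BoundedLattice M
  open LatticeNotions M using (lvl; IsChain)

  Ascending : (ℕ → Carrier) → Set ℓ₂
  Ascending f = ∀ n → f n ≤ f (suc n)

  ascending-mono : ∀ {f m n} → Ascending f → m ≤′ n → f m ≤ f n
  ascending-mono asc ≤′-refl        = refl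
  ascending-mono asc (≤′-step m≤′n) = trans (ascending-mono asc m≤′n) (asc _)

  module _ {f : ℕ → Carrier} (asc : Ascending f) where
    private
      Image : Pred Carrier lvl
      Image y = Lift lvl (∃ λ n → y ≈ f n)

      comparable : ∀ m n → f m ≤ f n ⊎ f n ≤ f m
      comparable m n =
        Sum.map (ascending-mono asc ∘ ℕₚ.≤⇒≤′) (ascending-mono asc ∘ ℕₚ.≤⇒≤′) (ℕₚ.≤-total m n)

      image-chain : IsChain Image
      image-chain x y (lift (m , x≈fm)) (lift (n , y≈fn)) =
        Sum.map (λ fm≤fn → ≤-respʳ-≈ (Eq.sym y≈fn) (≤-respˡ-≈ (Eq.sym x≈fm) fm≤fn))
                (λ fn≤fm → ≤-respʳ-≈ (Eq.sym x≈fm) (≤-respˡ-≈ (Eq.sym y≈fn) fn≤fm))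
                (comparable m n)

      elements : List Carrier
      elements = proj₁ (finite Image image-chain)

      member : ∀ n → Any (f n ≈_) elements
      member n = proj₂ (finite Image image-chain) (f n) (lift (n , Eq.refl))

      position : ℕ → Fin (length elements)
      position n = index (member n)

    ascending-repeats : ∃₂ λ m n → m ℕ.< n × f n ≤ f m
    ascending-repeats with pigeonhole (ℕₚ.n<1+n _) (position ∘ toℕ)
    ... | i , j , i<j , same = toℕ i , toℕ j , i<j , reflexive (begin
      f (toℕ j)                        ≈⟨ lookup-index (member (toℕ j)) ⟩
      lookup elements (position (toℕ j)) ≡⟨ cong (lookup elements) same ⟨
      lookup elements (position (toℕ i)) ≈⟨ lookup-index (member (toℕ i)) ⟨
      f (toℕ i)                        ∎)
      where open ≈-Reasoning setoid

  no-strictly-ascending : ∀ f → Ascending f → ¬ (∀ n → ¬ f (suc n) ≤ f n)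
  no-strictly-ascending f asc strict with ascending-repeats asc
  ... | m , n , m<n , fn≤fm = strict m (trans (ascending-mono asc (ℕₚ.≤⇒≤′ m<n)) fn≤fm)

  ∃-maximal : ∀ {p} (P : Pred Carrier p) {x} → P x →
    ∃ λ d → x ≤ d × P d × (∀ d' → d ≤ d' → P d' → d' ≤ d)
  ∃-maximal P {x} Px with lem {P = ∃ λ d → x ≤ d × P d × (∀ d' → d ≤ d' → P d' → d' ≤ d)}
  ... | yes maximal = maximal
  ... | no none = ⊥-elim (no-strictly-ascending (proj₁ ∘ chain) (proj₁ ∘ step) (proj₂ ∘ step))
    where
    Above : Set _
    Above = Σ Carrier λ y → x ≤ y × P y

    next : (y : Above) → Σ Above λ y' → proj₁ y ≤ proj₁ y' × ¬ proj₁ y' ≤ proj₁ y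
    next (y , x≤y , Py) with lem {P = ∃ λ y' → y ≤ y' × P y' × ¬ y' ≤ y}
    ... | yes (y' , y≤y' , Py' , y'≰y) = (y' , trans x≤y y≤y' , Py') , y≤y' , y'≰y
    ... | no stuck = ⊥-elim (none (y , x≤y , Py , λ d' y≤d' Pd' →
                       decidable-stable lem (λ d'≰y → stuck (d' , y≤d' , Pd' , d'≰y))))

    chain : ℕ → Above
    chain zero    = x , refl , Px
    chain (suc n) = proj₁ (next (chain n))

    step : ∀ n → proj₁ (chain n) ≤ proj₁ (chain (suc n)) × ¬ proj₁ (chain (suc n)) ≤ proj₁ (chain n)
    step n = proj₂ (next (chain n))

module Duality {c ℓ₁ ℓ₂} (M : BoundedLattice c ℓ₁ ℓ₂) where
  open BoundedLattice M
  open LatticeNotions M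
  open JoinProperties joinSemilattice using (∨-comm; ∨-cong)
  open MeetProperties meetSemilattice using (∧-comm; ∧-cong)

  dual : BoundedLattice c ℓ₁ ℓ₂
  dual = record
    { _≤_ = flip _≤_ ; _∨_ = _∧_ ; _∧_ = _∨_ ; ⊤ = ⊥ ; ⊥ = ⊤
    ; isBoundedLattice = record
      { isLattice = LatticeProperties.∧-∨-isLattice lattice
      ; maximum   = minimum
      ; minimum   = maximum
      }
    }

  module ᵈ = LatticeNotions dual

  dual-modular : IsModular → ᵈ.IsModular
  dual-modular modular x y z z≤x = begin
    x ∧ (y ∨ z)   ≈⟨ ∧-cong Eq.refl (∨-comm y z) ⟩
    x ∧ (z ∨ y)   ≈⟨ ∧-comm x (z ∨ y) ⟩
    (z ∨ y) ∧ x   ≈⟨ modular z y x z≤x ⟨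
    z ∨ (y ∧ x)   ≈⟨ ∨-cong Eq.refl (∧-comm y x) ⟩
    z ∨ (x ∧ y)   ≈⟨ ∨-comm z (x ∧ y) ⟩
    (x ∧ y) ∨ z   ∎
    where open ≈-Reasoning setoid

  dual-finiteLength : FiniteLength → ᵈ.FiniteLength
  dual-finiteLength finite C chain = finite C (λ x y Cx Cy → ⊎-swap (chain x y Cx Cy))

  ≻⇒≺ᵈ : ∀ {a b} → b ≺ a → a ᵈ.≺ b
  ≻⇒≺ᵈ ((b≤a , b≉a) , nothing-between) =
    (b≤a , b≉a ∘ Eq.sym) , λ (z , (z≤a , a≉z) , (b≤z , z≉b)) →
      nothing-between (z , (b≤z , z≉b ∘ Eq.sym) , (z≤a , a≉z ∘ Eq.sym))

  ≺ᵈ⇒≻ : ∀ {a b} → a ᵈ.≺ b → b ≺ a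
  ≺ᵈ⇒≻ ((b≤a , a≉b) , nothing-between) =
    (b≤a , a≉b ∘ Eq.sym) , λ (z , (b≤z , b≉z) , (z≤a , z≉a)) →
      nothing-between (z , (z≤a , z≉a ∘ Eq.sym) , (b≤z , b≉z ∘ Eq.sym))

  dual-isStar : ∀ {a s} → IsPlus a s → ᵈ.IsStar a s
  dual-isStar (bottom , infimum) =
    bottom , λ a≉⊥ → let lower , greatest = infimum a≉⊥ in
      (λ b a≺ᵈb → lower b (≺ᵈ⇒≻ a≺ᵈb)) , (λ u below → greatest u (λ b b≺a → below b (≻⇒≺ᵈ b≺a)))

  dual-isPlus : ∀ {a s} → IsStar a s → ᵈ.IsPlus a s
  dual-isPlus (top , supremum) =
    top , λ a≉⊤ → let upper , least = supremum a≉⊤ in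
      (λ b b≺ᵈa → upper b (≺ᵈ⇒≻ b≺ᵈa)) , (λ u above → least u (λ b a≺b → above b (≻⇒≺ᵈ a≺b)))

module Core {c ℓ₁ ℓ₂} (M : BoundedLattice c ℓ₁ ℓ₂)
  (lem : ∀ {ℓ} → ExcludedMiddle ℓ)
  (modular : LatticeNotions.IsModular M) (finite : LatticeNotions.FiniteLength M)
  (star plus : BoundedLattice.Carrier M → BoundedLattice.Carrier M)
  (isStar : ∀ a → LatticeNotions.IsStar M a (star a))
  (isPlus : ∀ a → LatticeNotions.IsPlus M a (plus a)) where
  open BoundedLattice M
  open LatticeNotions M
  open JoinProperties joinSemilattice using (∨-monotonic; ∨-comm)
  open MeetProperties meetSemilattice using (∧-monotonic)
  open ChainConditions M lem finite using (∃-maximal)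
  open ChainConditions (Duality.dual M) lem (Duality.dual-finiteLength M finite)
    using () renaming (∃-maximal to ∃-minimal)

  infix 4 _⋖_
  record _⋖_ (a b : Carrier) : Set (c ⊔ ℓ₂) where
    constructor mk⋖
    field
      ⋖⇒≤     : a ≤ b
      ⋖⇒≱     : ¬ b ≤ a
      ⋖-split : ∀ {z} → a ≤ z → z ≤ b → z ≤ a ⊎ b ≤ z
  open _⋖_ public

  ≺⇒⋖ : ∀ {a b} → a ≺ b → a ⋖ b
  ≺⇒⋖ {a} {b} ((a≤b , a≉b) , nothing-between) = mk⋖ a≤b (a≉b ∘ antisym a≤b) split
    where
    split : ∀ {z} → a ≤ z → z ≤ b → z ≤ a ⊎ b ≤ z
    split {z} a≤z z≤b with lem {P = z ≤ a} | lem {P = b ≤ z}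
    ... | yes z≤a | _       = inj₁ z≤a
    ... | no _    | yes b≤z = inj₂ b≤z
    ... | no z≰a  | no b≰z  = ⊥-elim (nothing-between
      (z , (a≤z , z≰a ∘ reflexive ∘ Eq.sym) , (z≤b , b≰z ∘ reflexive ∘ Eq.sym)))

  ⋖⇒≺ : ∀ {a b} → a ⋖ b → a ≺ b
  ⋖⇒≺ (mk⋖ a≤b b≰a split) =
    (a≤b , b≰a ∘ reflexive ∘ Eq.sym) , λ (z , (a≤z , a≉z) , (z≤b , z≉b)) →
      [ a≉z ∘ antisym a≤z , z≉b ∘ antisym z≤b ]′ (split a≤z z≤b)

  ⋖-respˡ-≈ : ∀ {a a' b} → a ≈ a' → a ⋖ b → a' ⋖ b
  ⋖-respˡ-≈ a≈a' (mk⋖ a≤b b≰a split) =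
    mk⋖ (≤-respˡ-≈ a≈a' a≤b) (b≰a ∘ ≤-respʳ-≈ (Eq.sym a≈a'))
        (λ a'≤z z≤b → Sum.map₁ (≤-respʳ-≈ a≈a') (split (≤-respˡ-≈ (Eq.sym a≈a') a'≤z) z≤b))

  ∃-⋖-above : ∀ {a b} → a ≤ b → ¬ b ≤ a → ∃ λ p → a ⋖ p × p ≤ b
  ∃-⋖-above {a} a≤b b≰a with ∃-minimal (λ p → a ≤ p × ¬ p ≤ a) (a≤b , b≰a)
  ... | p , p≤b , (a≤p , p≰a) , minimal = p , mk⋖ a≤p p≰a split , p≤b
    where
    split : ∀ {z} → a ≤ z → z ≤ p → z ≤ a ⊎ p ≤ z
    split {z} a≤z z≤p with lem {P = z ≤ a}
    ... | yes z≤a = inj₁ z≤a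
    ... | no z≰a  = inj₂ (minimal z z≤p (a≤z , z≰a))

  ∃-⋖-below : ∀ {a b} → a ≤ b → ¬ b ≤ a → ∃ λ h → a ≤ h × h ⋖ b
  ∃-⋖-below {b = b} a≤b b≰a with ∃-maximal (λ h → h ≤ b × ¬ b ≤ h) (a≤b , b≰a)
  ... | h , a≤h , (h≤b , b≰h) , maximal = h , a≤h , mk⋖ h≤b b≰h split
    where
    split : ∀ {z} → h ≤ z → z ≤ b → z ≤ h ⊎ b ≤ z
    split {z} h≤z z≤b with lem {P = b ≤ z}
    ... | yes b≤z = inj₂ b≤z
    ... | no b≰z  = inj₁ (maximal z h≤z (z≤b , b≰z))

  ⋖⇒≤star : ∀ {a b} → a ⋖ b → b ≤ star a
  ⋖⇒≤star {a} {b} a⋖b with lem {P = a ≈ ⊤}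
  ... | yes a≈⊤ = ⊥-elim (⋖⇒≱ a⋖b (≤-respʳ-≈ (Eq.sym a≈⊤) (maximum b)))
  ... | no a≉⊤  = proj₁ (proj₂ (isStar a) a≉⊤) b (⋖⇒≺ a⋖b)

  star-least : ∀ {a u} → a ≤ u → (∀ b → a ⋖ b → b ≤ u) → star a ≤ u
  star-least {a} {u} a≤u bound with lem {P = a ≈ ⊤}
  ... | yes a≈⊤ = ≤-respˡ-≈ (Eq.trans a≈⊤ (Eq.sym (proj₁ (isStar a) a≈⊤))) a≤u
  ... | no a≉⊤  = proj₂ (proj₂ (isStar a) a≉⊤) u (λ b a≺b → bound b (≺⇒⋖ a≺b))

  ⋖⇒plus≤ : ∀ {a b} → b ⋖ a → plus a ≤ b
  ⋖⇒plus≤ {a} {b} b⋖a with lem {P = a ≈ ⊥}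
  ... | yes a≈⊥ = ⊥-elim (⋖⇒≱ b⋖a (≤-respˡ-≈ (Eq.sym a≈⊥) (minimum b)))
  ... | no a≉⊥  = proj₁ (proj₂ (isPlus a) a≉⊥) b (⋖⇒≺ b⋖a)

  ≤-star : ∀ a → a ≤ star a
  ≤-star a with lem {P = a ≈ ⊤}
  ... | yes a≈⊤ = ≤-respʳ-≈ (Eq.sym (proj₁ (isStar a) a≈⊤)) (maximum a)
  ... | no a≉⊤ with ∃-⋖-above (maximum a) (a≉⊤ ∘ antisym (maximum a))
  ...   | p , a⋖p , _ = trans (⋖⇒≤ a⋖p) (⋖⇒≤star a⋖p)

  plus≤ : ∀ a → plus a ≤ a
  plus≤ a with lem {P = a ≈ ⊥}
  ... | yes a≈⊥ = ≤-respˡ-≈ (Eq.sym (proj₁ (isPlus a) a≈⊥)) (minimum a)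
  ... | no a≉⊥ with ∃-⋖-below (minimum a) (a≉⊥ ∘ flip antisym (minimum a))
  ...   | h , _ , h⋖a = trans (⋖⇒plus≤ h⋖a) (⋖⇒≤ h⋖a)

  star-cong : ∀ {a b} → a ≈ b → star a ≈ star b
  star-cong a≈b = antisym (star-mono-≈ a≈b) (star-mono-≈ (Eq.sym a≈b))
    where
    star-mono-≈ : ∀ {a b} → a ≈ b → star a ≤ star b
    star-mono-≈ {b = b} a≈b =
      star-least (≤-respˡ-≈ (Eq.sym a≈b) (≤-star b)) (λ p a⋖p → ⋖⇒≤star (⋖-respˡ-≈ a≈b a⋖p))

  modular≤ : ∀ {x y z} → x ≤ z → (x ∨ y) ∧ z ≤ x ∨ (y ∧ z)
  modular≤ {x} {y} {z} x≤z = reflexive (Eq.sym (modular x y z x≤z))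

  modular-cancel : ∀ {w q d} → w ≤ q → q ∧ d ≤ w → q ≤ w ∨ d → q ≤ w
  modular-cancel {w} {q} {d} w≤q q∧d≤w q≤w∨d = begin
    q                ≤⟨ ∧-greatest q≤w∨d refl ⟩
    (w ∨ d) ∧ q      ≤⟨ modular≤ w≤q ⟩
    w ∨ (d ∧ q)      ≤⟨ ∨-least refl (trans (∧-greatest (x∧y≤y d q) (x∧y≤x d q)) q∧d≤w) ⟩
    w                ∎
    where open ≤-Reasoning poset

  ⋖-∨-transpose : ∀ {x p s} → x ⋖ p → x ≤ s → p ≤ s ⊎ s ⋖ p ∨ s
  ⋖-∨-transpose {x} {p} {s} x⋖p x≤s with lem {P = p ≤ s}
  ... | yes p≤s = inj₁ p≤s
  ... | no p≰s  = inj₂ (mk⋖ (y≤x∨y p s) (p≰s ∘ trans (x≤x∨y p s)) split)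
    where
    split : ∀ {w} → s ≤ w → w ≤ p ∨ s → w ≤ s ⊎ p ∨ s ≤ w
    split {w} s≤w w≤p∨s = Sum.map
      (λ w∧p≤x → modular-cancel s≤w (trans w∧p≤x x≤s) (≤-respʳ-≈ (∨-comm p s) w≤p∨s))
      (λ p≤w∧p → ∨-least (trans p≤w∧p (x∧y≤x w p)) s≤w)
      (⋖-split x⋖p (∧-greatest (trans x≤s s≤w) (⋖⇒≤ x⋖p)) (x∧y≤y w p))

  ⋖-∧-transpose : ∀ {x p e} → x ⋖ p → e ≤ p → ¬ e ≤ x → x ∧ e ⋖ e
  ⋖-∧-transpose {x} {p} {e} x⋖p e≤p e≰x = mk⋖ (x∧y≤y x e) (e≰x ∘ flip trans (x∧y≤x x e)) split
    where
    split : ∀ {w} → x ∧ e ≤ w → w ≤ e → w ≤ x ∧ e ⊎ e ≤ w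
    split {w} x∧e≤w w≤e = Sum.map
      (λ x∨w≤x → ∧-greatest (trans (y≤x∨y x w) x∨w≤x) w≤e)
      (λ p≤x∨w → modular-cancel w≤e (trans (∧-greatest (x∧y≤y e x) (x∧y≤x e x)) x∧e≤w)
                                    (trans e≤p (≤-respʳ-≈ (∨-comm x w) p≤x∨w)))
      (⋖-split x⋖p (x≤x∨y x w) (∨-least (⋖⇒≤ x⋖p) (trans w≤e e≤p)))

  MaximalAvoiding : Carrier → Carrier → Carrier → Set (c ⊔ ℓ₂)
  MaximalAvoiding a z d = a ≤ d × d ∧ z ≤ a × (∀ d' → d ≤ d' → d' ∧ z ≤ a → d' ≤ d)

  ∃-maximalAvoiding : ∀ a z → ∃ (MaximalAvoiding a z)
  ∃-maximalAvoiding a z = ∃-maximal (λ d → d ∧ z ≤ a) (x∧y≤x a z)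

  -- q is the image of p under the perspectivity [d, p ∨ d] ↘ [a, (p ∨ d) ∧ z].
  perspective-atom : ∀ {a z d p} → a ≤ z → MaximalAvoiding a z d → a ⋖ p → ¬ p ≤ d →
                ∃ λ q → a ⋖ q × q ≤ z × p ≤ d ∨ q
  perspective-atom {a} {z} {d} {p} a≤z (a≤d , d∧z≤a , maximal) a⋖p p≰d =
    q , ⋖-respˡ-≈ d∧q≈a (⋖-∧-transpose d⋖p∨d (x∧y≤x (p ∨ d) z) q≰d) , x∧y≤y (p ∨ d) z , p≤d∨q
    where
    q = (p ∨ d) ∧ z

    d⋖p∨d : d ⋖ p ∨ d
    d⋖p∨d = [ ⊥-elim ∘ p≰d , id ]′ (⋖-∨-transpose a⋖p a≤d)

    q≰d : ¬ q ≤ d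
    q≰d q≤d = ⋖⇒≱ d⋖p∨d (maximal (p ∨ d) (y≤x∨y p d)
      (trans (∧-greatest q≤d (x∧y≤y (p ∨ d) z)) d∧z≤a))

    d∧q≈a : d ∧ q ≈ a
    d∧q≈a = antisym (trans (∧-monotonic refl (x∧y≤y (p ∨ d) z)) d∧z≤a)
                    (∧-greatest a≤d (∧-greatest (trans a≤d (y≤x∨y p d)) a≤z))

    p≤d∨q : p ≤ d ∨ q
    p≤d∨q = [ ⊥-elim ∘ q≰d ∘ trans (y≤x∨y d q) , trans (x≤x∨y p d) ]′
              (⋖-split d⋖p∨d (x≤x∨y d q) (∨-least (y≤x∨y p d) (x∧y≤x (p ∨ d) z)))

  star≤maximalAvoiding∨ : ∀ {a z d v} → a ≤ z → MaximalAvoiding a z d →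
                          (∀ q → a ⋖ q → q ≤ z → q ≤ v) → star a ≤ d ∨ v
  star≤maximalAvoiding∨ {a} {z} {d} {v} a≤z avoiding@(a≤d , _) atoms≤v =
    star-least (trans a≤d (x≤x∨y d v)) atom≤d∨v
    where
    atom≤d∨v : ∀ p → a ⋖ p → p ≤ d ∨ v
    atom≤d∨v p a⋖p with lem {P = p ≤ d}
    ... | yes p≤d = trans p≤d (x≤x∨y d v)
    ... | no p≰d with perspective-atom a≤z avoiding a⋖p p≰d
    ...   | q , a⋖q , q≤z , p≤d∨q = trans p≤d∨q (∨-monotonic refl (atoms≤v q a⋖q q≤z))

  star-interval-atomistic : ∀ {a v z} → a ≤ v → v ≤ z → z ≤ star a →
                            (∀ q → a ⋖ q → q ≤ z → q ≤ v) → z ≤ v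
  star-interval-atomistic {a} {v} {z} a≤v v≤z z≤a* atoms≤v with ∃-maximalAvoiding a z
  ... | d , avoiding@(_ , d∧z≤a , _) =
    modular-cancel v≤z (trans (∧-greatest (x∧y≤y z d) (x∧y≤x z d)) (trans d∧z≤a a≤v))
      (trans z≤a* (≤-respʳ-≈ (∨-comm d v)
        (star≤maximalAvoiding∨ (trans a≤v v≤z) avoiding atoms≤v)))

  star-interval-coatomistic : ∀ {c w y} → c ≤ w → w ≤ y → y ≤ star c →
                              (∀ h → h ⋖ y → c ≤ h → w ≤ h) → w ≤ c
  star-interval-coatomistic {c} {w} {y} c≤w w≤y y≤c* coatoms≥w with ∃-maximalAvoiding c w
  ... | d , avoiding@(c≤d , d∧w≤c , _) with lem {P = y ≤ d}
  ...   | yes y≤d = trans (∧-greatest (trans w≤y y≤d) refl) d∧w≤c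
  ...   | no y≰d with ∃-⋖-below (x∧y≤y d y) (y≰d ∘ flip trans (x∧y≤x d y))
  ...     | h , d∧y≤h , h⋖y = ⊥-elim (⋖⇒≱ h⋖y (begin
    y                 ≤⟨ ∧-greatest (trans y≤c* c*≤d∨w) refl ⟩
    (d ∨ w) ∧ y       ≤⟨ ∧-monotonic (reflexive (∨-comm d w)) refl ⟩
    (w ∨ d) ∧ y       ≤⟨ modular≤ w≤y ⟩
    w ∨ (d ∧ y)       ≤⟨ ∨-least (coatoms≥w h h⋖y c≤h) d∧y≤h ⟩
    h                 ∎))
    where
    open ≤-Reasoning poset
    c*≤d∨w : star c ≤ d ∨ w
    c*≤d∨w = star≤maximalAvoiding∨ c≤w avoiding (λ q _ q≤w → q≤w)
    c≤h : c ≤ h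
    c≤h = trans (∧-greatest c≤d (trans c≤w w≤y)) d∧y≤h

  star-interval-plus≤ : ∀ {c y} → c ≤ y → y ≤ star c → plus y ≤ c
  star-interval-plus≤ {c} {y} c≤y y≤c* =
    trans (x≤x∨y (plus y) c)
      (star-interval-coatomistic (y≤x∨y (plus y) c) (∨-least (plus≤ y) c≤y) y≤c*
        (λ h h⋖y c≤h → ∨-least (⋖⇒plus≤ h⋖y) c≤h))

  plus∘star≤ : ∀ x → plus (star x) ≤ x
  plus∘star≤ x = star-interval-plus≤ (≤-star x) refl

  star-∧-transpose : ∀ {p t} → p ∨ t ≤ star t → p ≤ star (p ∧ t)
  star-∧-transpose {p} {t} p∨t≤t* = trans p≤z (x∧y≤y p (star (p ∧ t)))
    where
    z = p ∧ star (p ∧ t)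

    atom≤z∨t : ∀ r → t ⋖ r → r ≤ p ∨ t → r ≤ z ∨ t
    atom≤z∨t r t⋖r r≤p∨t = trans r≤t∨p∧r (∨-least (y≤x∨y z t) (trans p∧r≤z (x≤x∨y z t)))
      where
      r≤t∨p∧r : r ≤ t ∨ (p ∧ r)
      r≤t∨p∧r = trans (∧-greatest (≤-respʳ-≈ (∨-comm p t) r≤p∨t) refl) (modular≤ (⋖⇒≤ t⋖r))

      p∧r≰t : ¬ p ∧ r ≤ t
      p∧r≰t p∧r≤t = ⋖⇒≱ t⋖r (trans r≤t∨p∧r (∨-least refl p∧r≤t))

      t∧p∧r≈p∧t : t ∧ (p ∧ r) ≈ p ∧ t
      t∧p∧r≈p∧t = antisym (∧-greatest (trans (x∧y≤y t (p ∧ r)) (x∧y≤x p r)) (x∧y≤x t (p ∧ r)))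
        (∧-greatest (x∧y≤y p t) (∧-greatest (x∧y≤x p t) (trans (x∧y≤y p t) (⋖⇒≤ t⋖r))))

      p∧r≤z : p ∧ r ≤ z
      p∧r≤z = ∧-greatest (x∧y≤x p r)
        (⋖⇒≤star (⋖-respˡ-≈ t∧p∧r≈p∧t (⋖-∧-transpose t⋖r (x∧y≤y p r) p∧r≰t)))

    p≤z : p ≤ z
    p≤z = modular-cancel (x∧y≤x p (star (p ∧ t))) (∧-greatest (x∧y≤x p t) (≤-star (p ∧ t)))
            (trans (x≤x∨y p t) (star-interval-atomistic (y≤x∨y z t)
               (∨-monotonic (x∧y≤x p (star (p ∧ t))) refl) p∨t≤t* atom≤z∨t))

  ⋖-≤-star : ∀ {x p s} → x ⋖ p → x ≤ s → p ≤ star s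
  ⋖-≤-star {x} {p} {s} x⋖p x≤s =
    [ flip trans (≤-star s) , trans (x≤x∨y p s) ∘ ⋖⇒≤star ]′ (⋖-∨-transpose x⋖p x≤s)

  module _ {s t} (s*≤t* : star s ≤ star t) where

    ≤star-∧ : ∀ {y} → y ≤ star s → y ≤ star (y ∧ t)
    ≤star-∧ {y} y≤s* = star-∧-transpose (∨-least (trans y≤s* s*≤t*) (≤-star t))

    star-∧-≥ : ∀ {x} → x ≤ s → star x ≤ star (x ∧ t)
    star-∧-≥ {x} x≤s = star-least x≤[x∧t]* atom≤[x∧t]*
      where
      x≤[x∧t]* : x ≤ star (x ∧ t)
      x≤[x∧t]* = ≤star-∧ (trans x≤s (≤-star s))

      atom≤[x∧t]* : ∀ p → x ⋖ p → p ≤ star (x ∧ t)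
      atom≤[x∧t]* p x⋖p with lem {P = p ∧ t ≤ x}
      ... | yes p∧t≤x = trans (≤star-∧ (⋖-≤-star x⋖p x≤s)) (reflexive (star-cong p∧t≈x∧t))
        where
        p∧t≈x∧t : p ∧ t ≈ x ∧ t
        p∧t≈x∧t = antisym (∧-greatest p∧t≤x (x∧y≤y p t)) (∧-monotonic (⋖⇒≤ x⋖p) refl)
      ... | no p∧t≰x =
        [ ⊥-elim ∘ p∧t≰x ∘ trans (y≤x∨y x (p ∧ t)) , flip trans (∨-least x≤[x∧t]* p∧t≤[x∧t]*) ]′
          (⋖-split x⋖p (x≤x∨y x (p ∧ t)) (∨-least (⋖⇒≤ x⋖p) (x∧y≤x p t)))
        where
        x∧p∧t≈x∧t : x ∧ (p ∧ t) ≈ x ∧ t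
        x∧p∧t≈x∧t = antisym (∧-monotonic refl (x∧y≤y p t))
                            (∧-greatest (x∧y≤x x t) (∧-monotonic (⋖⇒≤ x⋖p) refl))

        p∧t≤[x∧t]* : p ∧ t ≤ star (x ∧ t)
        p∧t≤[x∧t]* = ⋖⇒≤star (⋖-respˡ-≈ x∧p∧t≈x∧t (⋖-∧-transpose x⋖p (x∧y≤x p t) p∧t≰x))

module MaximalAtomisticIntervals {c ℓ₁ ℓ₂} (M : BoundedLattice c ℓ₁ ℓ₂)
  (lem : ∀ {ℓ} → ExcludedMiddle ℓ)
  (modular : LatticeNotions.IsModular M) (finite : LatticeNotions.FiniteLength M)
  (star plus : BoundedLattice.Carrier M → BoundedLattice.Carrier M)
  (isStar : ∀ a → LatticeNotions.IsStar M a (star a))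
  (isPlus : ∀ a → LatticeNotions.IsPlus M a (plus a)) where
  open BoundedLattice M
  open LatticeNotions M
  open Duality M using (dual; dual-modular; dual-finiteLength; dual-isStar; dual-isPlus)
  open Core M lem modular finite star plus isStar isPlus public
  module Dual = Core dual lem (dual-modular modular) (dual-finiteLength finite) plus star
                     (dual-isStar ∘ isPlus) (dual-isPlus ∘ isStar)

  ≤star∘plus : ∀ x → x ≤ star (plus x)
  ≤star∘plus = Dual.plus∘star≤

  plus-cong : ∀ {a b} → a ≈ b → plus a ≈ plus b
  plus-cong = Dual.star-cong

  StarMinimal : Carrier → Set (c ⊔ ℓ₂)
  StarMinimal x = ∀ y → y ≤ x → star x ≤ star y → x ≤ y

  plus-starMinimal : ∀ y → StarMinimal (plus y)
  plus-starMinimal y c c≤y⁺ y⁺*≤c* =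
    star-interval-plus≤ (trans c≤y⁺ (plus≤ y)) (trans (≤star∘plus y) y⁺*≤c*)

  starMinimal⇔fixed : ∀ {x} → StarMinimal x ⇔ plus (star x) ≈ x
  starMinimal⇔fixed {x} = mk⇔
    (λ minimal → antisym (plus∘star≤ x) (minimal _ (plus∘star≤ x) (≤star∘plus (star x))))
    (λ fixed y y≤x x*≤y* → ≤-respˡ-≈ fixed (star-interval-plus≤ (trans y≤x (≤-star x)) x*≤y*))

  starMinimal-≤-plus∘star : ∀ {x s} → StarMinimal x → x ≤ s → x ≤ plus (star s)
  starMinimal-≤-plus∘star {x} {s} minimal x≤s =
    trans (minimal (x ∧ t) (x∧y≤x x t) (star-∧-≥ (≤star∘plus (star s)) x≤s)) (x∧y≤y x t)
    where t = plus (star s)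

  atomistic⇒≤star : ∀ {a b} → IsAtomistic a b → b ≤ star a
  atomistic⇒≤star {a} {b} (a≤b , decompose) with decompose b a≤b refl
  ... | A , atoms , (_ , _ , least) =
    trans (least (b ∧ star a) (∧-greatest a≤b (≤-star a)) (x∧y≤x b (star a)) A≤b∧a*)
          (x∧y≤y b (star a))
    where
    A≤b∧a* : ∀ w → A w → w ≤ b ∧ star a
    A≤b∧a* w Aw = let a≺w , w≤b = atoms w Aw in ∧-greatest w≤b (⋖⇒≤star (≺⇒⋖ a≺w))

  ≤star⇒atomistic : ∀ {a b} → a ≤ b → b ≤ star a → IsAtomistic a b
  ≤star⇒atomistic {a} {b} a≤b b≤a* = a≤b , λ z a≤z z≤b →
    IsAtomOf a z , (λ w (a≺w , w≤z) → a≺w , trans w≤z z≤b) ,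
    ((a≤z , z≤b) , (λ w → proj₂) , λ u a≤u _ atoms≤u →
      trans (star-interval-atomistic (∧-greatest a≤u a≤z) (x∧y≤y u z) (trans z≤b b≤a*)
               (λ q a⋖q q≤z → ∧-greatest (atoms≤u q (⋖⇒≺ a⋖q , q≤z)) q≤z))
            (x∧y≤x u z))

  maxAtomistic⇔ : ∀ {a b} → IsMaxAtomistic a b ⇔ (StarMinimal a × b ≈ star a)
  maxAtomistic⇔ {a} {b} = mk⇔ to from
    where
    to : IsMaxAtomistic a b → StarMinimal a × b ≈ star a
    to (atomistic , maximal) = minimal , b≈a*
      where
      b≤a* : b ≤ star a
      b≤a* = atomistic⇒≤star atomistic

      b≈a* : b ≈ star a
      b≈a* = Eq.sym (proj₂ (maximal a (star a) (≤star⇒atomistic (≤-star a) refl) refl b≤a*))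

      minimal : StarMinimal a
      minimal y y≤a a*≤y* = reflexive (Eq.sym (proj₁
        (maximal y (star a) (≤star⇒atomistic (trans y≤a (≤-star a)) a*≤y*) y≤a b≤a*)))

    from : StarMinimal a × b ≈ star a → IsMaxAtomistic a b
    from (minimal , b≈a*) =
      ≤star⇒atomistic (≤-respʳ-≈ (Eq.sym b≈a*) (≤-star a)) (reflexive b≈a*) , maximal
      where
      maximal : ∀ c d → IsAtomistic c d → c ≤ a → b ≤ d → c ≈ a × d ≈ b
      maximal c d c-d-atomistic c≤a b≤d = c≈a , antisym d≤b b≤d
        where
        d≤c* : d ≤ star c
        d≤c* = atomistic⇒≤star c-d-atomistic

        c≈a : c ≈ a
        c≈a = antisym c≤a (minimal c c≤a (≤-respˡ-≈ b≈a* (trans b≤d d≤c*)))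

        d≤b : d ≤ b
        d≤b = trans d≤c* (reflexive (Eq.trans (star-cong c≈a) (Eq.sym b≈a*)))

  inS⇔starMinimal : ∀ {x} → InS x ⇔ StarMinimal x
  inS⇔starMinimal = mk⇔ (proj₁ ∘ Equivalence.to maxAtomistic⇔ ∘ proj₂)
                        (λ minimal → _ , Equivalence.from maxAtomistic⇔ (minimal , Eq.refl))

  inS-≤-plus∘star : ∀ {x s} → InS x → x ≤ s → x ≤ plus (star s)
  inS-≤-plus∘star = starMinimal-≤-plus∘star ∘ Equivalence.to inS⇔starMinimal

  inS-plus : ∀ y → InS (plus y)
  inS-plus = Equivalence.from inS⇔starMinimal ∘ plus-starMinimal

  inS⇔fixed : ∀ {x} → InS x ⇔ plus (star x) ≈ x
  inS⇔fixed = starMinimal⇔fixed ⇔-∘ inS⇔starMinimal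

  inS-∨ : ∀ {x y} → InS x → InS y → InS (x ∨ y)
  inS-∨ {x} {y} x∈S y∈S = Equivalence.from inS⇔fixed
    (antisym (plus∘star≤ (x ∨ y))
             (∨-least (inS-≤-plus∘star x∈S (x≤x∨y x y)) (inS-≤-plus∘star y∈S (y≤x∨y x y))))

  maxAtomistic⇔inS : ∀ {a b} → IsMaxAtomistic a b ⇔ (InS a × b ≈ star a)
  maxAtomistic⇔inS = mk⇔
    (Product.map₁ (Equivalence.from inS⇔starMinimal) ∘ Equivalence.to maxAtomistic⇔)
    (Equivalence.from maxAtomistic⇔ ∘ Product.map₁ (Equivalence.to inS⇔starMinimal))

theorem6p2 : ∀ {c ℓ₁ ℓ₂ : Level} (M : BoundedLattice c ℓ₁ ℓ₂) →
    let open BoundedLattice M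
        open LatticeNotions M
    in (∀ {ℓ : Level} → ExcludedMiddle ℓ) →
       IsModular → FiniteLength →
       (star plus : Carrier → Carrier) →
       (∀ a → IsStar a (star a)) → (∀ a → IsPlus a (plus a)) →
       -- (f)
       ((∀ x → InS x ⇔ (plus (star x) ≈ x)) ×
        (∀ a b → IsMaxAtomistic a b ⇔ (InS a × b ≈ star a))) ×
       -- (g) sub-join-semilattice with greatest element 1⁺ and least element 0
       ((∀ x y → InS x → InS y → InS (x ∨ y)) ×
        (InS (plus ⊤) × (∀ x → InS x → x ≤ plus ⊤)) ×
        (InS ⊥ × (∀ x → InS x → ⊥ ≤ x)) ×
       -- (g) S(M) is a lattice: join x + y, meet (x · y)*⁺
        (∀ x y → InS x → InS y →
          (x ≤ x ∨ y × y ≤ x ∨ y ×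
           (∀ z → InS z → x ≤ z → y ≤ z → x ∨ y ≤ z)) ×
          (InS (plus (star (x ∧ y))) ×
           plus (star (x ∧ y)) ≤ x × plus (star (x ∧ y)) ≤ y ×
           (∀ z → InS z → z ≤ x → z ≤ y → z ≤ plus (star (x ∧ y))))))
theorem6p2 M lem modular finite star plus isStar isPlus =
  ((λ _ → inS⇔fixed) , (λ _ _ → maxAtomistic⇔inS)) ,
  (λ _ _ → inS-∨) ,
  (inS-plus ⊤ , λ x x∈S → trans (inS-≤-plus∘star x∈S (maximum x)) (reflexive (plus-cong star⊤≈⊤))) ,
  (Equivalence.from inS⇔starMinimal (λ y _ _ → minimum y) , λ x _ → minimum x) ,
  λ x y _ _ →
    (x≤x∨y x y , y≤x∨y x y , λ _ _ → ∨-least) ,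
    (inS-plus (star (x ∧ y)) ,
     trans (plus∘star≤ (x ∧ y)) (x∧y≤x x y) , trans (plus∘star≤ (x ∧ y)) (x∧y≤y x y) ,
     λ z z∈S z≤x z≤y → inS-≤-plus∘star z∈S (∧-greatest z≤x z≤y))
  where
  open BoundedLattice M
  open MaximalAtomisticIntervals M lem modular finite star plus isStar isPlus
  star⊤≈⊤ : star ⊤ ≈ ⊤
  star⊤≈⊤ = proj₁ (isStar ⊤) Eq.refl
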